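{- Let $\mathcal V$ be an ms-full variety, $n$ a natural number, and $\theta$ a factor congruence on the free algebra $F_{\mathcal V}(n)$ such that $F_{\mathcal V}(n)/\theta$ is nontrivial. Then $F_{\mathcal V}(n)/\theta$ is projective in $\mathcal V$ if and only if $F_{\mathcal V}(n)/\theta$ is mh-full.
   Context: All algebras are of a fixed finite similarity type. A nontrivial algebra is minimal if it has no proper subalgebra. A variety $\mathcal V$ is ms-full if every nontrivial algebra of $\mathcal V$ has at least one minimal subalgebra. An algebra $A\in\mathcal V$ is mh-full if every minimal algebra of $\mathcal V$ is (isomorphic to) a homomorphic image of $A$. A congruence $\theta$ on $A$ is a factor congruence if there is a congruence $\theta'$ with $\theta\cap\theta'$ the identity congruence, $\theta\vee\theta'$ the total congruence, and $\theta,\theta'$ permuting. Projective in $\mathcal V$ means being a retract of a free algebra of $\mathcal V$. -}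

module Defs where

open import Level using (0ℓ)
open import Data.Nat using (ℕ)
open import Data.Fin using (Fin)
open import Data.Product using (Σ; Σ-syntax; ∃; _×_; _,_; proj₁; proj₂)
open import Relation.Nullary using (¬_)
open import Relation.Binary using (Rel; IsEquivalence)

record Sig : Set where
  field
    nops  : ℕ
    arity : Fin nops → ℕ

module _ (S : Sig) where
  open Sig S

  data Term (X : Set) : Set where
    var : X → Term X
    app : (f : Fin nops) → (Fin (arity f) → Term X) → Term X

  sub : {X : Set} → Term ℕ → (ℕ → Term X) → Term X
  sub (var x) σ = σ x
  sub (app f ts) σ = app f (λ i → sub (ts i) σ)

  -- A set of identities (presenting a variety).
  Eqns : Set₁
  Eqns = Term ℕ → Term ℕ → Set

  record Algebra : Set₁ where
    field
      Carrier : Set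
      _≈_     : Rel Carrier 0ℓ
      isEquiv : IsEquivalence _≈_
      op      : (f : Fin nops) → (Fin (arity f) → Carrier) → Carrier
      op-cong : ∀ f {xs ys : Fin (arity f) → Carrier} →
                (∀ i → xs i ≈ ys i) → op f xs ≈ op f ys

  open Algebra

  eval : (A : Algebra) → (ℕ → Carrier A) → Term ℕ → Carrier A
  eval A ρ (var x) = ρ x
  eval A ρ (app f ts) = op A f (λ i → eval A ρ (ts i))

  Satisfies : Eqns → Algebra → Set
  Satisfies E A = ∀ s t → E s t → ∀ (ρ : ℕ → Carrier A) →
                  _≈_ A (eval A ρ s) (eval A ρ t)

  Nontrivial : Algebra → Set
  Nontrivial A = Σ[ a ∈ Carrier A ] Σ[ b ∈ Carrier A ] ¬ (_≈_ A a b)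

  record Hom (A B : Algebra) : Set where
    field
      fun   : Carrier A → Carrier B
      cong  : ∀ {x y} → _≈_ A x y → _≈_ B (fun x) (fun y)
      hom   : ∀ f (xs : Fin (arity f) → Carrier A) →
              _≈_ B (fun (op A f xs)) (op B f (λ i → fun (xs i)))

  open Hom

  Surjective : {A B : Algebra} → Hom A B → Set
  Surjective {A} {B} h = ∀ (b : Carrier B) → Σ[ a ∈ Carrier A ] _≈_ B (fun h a) b

  record Subuniverse (A : Algebra) (P : Carrier A → Set) : Set where
    field
      respects : ∀ {x y} → _≈_ A x y → P x → P y
      closed   : ∀ f (xs : Fin (arity f) → Carrier A) →
                 (∀ i → P (xs i)) → P (op A f xs)

  SubAlg : (A : Algebra) (P : Carrier A → Set) → Subuniverse A P → Algebra
  SubAlg A P su = record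
    { Carrier = Σ (Carrier A) P
    ; _≈_ = λ x y → _≈_ A (proj₁ x) (proj₁ y)
    ; isEquiv = record
        { refl = IsEquivalence.refl (isEquiv A)
        ; sym = IsEquivalence.sym (isEquiv A)
        ; trans = IsEquivalence.trans (isEquiv A) }
    ; op = λ f xs → op A f (λ i → proj₁ (xs i)) ,
                    Subuniverse.closed su f _ (λ i → proj₂ (xs i))
    ; op-cong = λ f eqs → op-cong A f eqs }

  Minimal : Algebra → Set₁
  Minimal A = Nontrivial A ×
              (∀ (P : Carrier A → Set) → Subuniverse A P →
                 Σ (Carrier A) P → ∀ x → P x)

  HasMinimalSubalgebra : Algebra → Set₁
  HasMinimalSubalgebra A =
    Σ[ P ∈ (Carrier A → Set) ] Σ[ su ∈ Subuniverse A P ] Minimal (SubAlg A P su)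

  -- Congruences (contain the setoid equality = identity congruence).
  record Congruence (A : Algebra) (θ : Rel (Carrier A) 0ℓ) : Set where
    field
      equiv  : IsEquivalence θ
      ≈⊆θ    : ∀ {x y} → _≈_ A x y → θ x y
      compat : ∀ f {xs ys : Fin (arity f) → Carrier A} →
               (∀ i → θ (xs i) (ys i)) → θ (op A f xs) (op A f ys)

  Quot : (A : Algebra) (θ : Rel (Carrier A) 0ℓ) → Congruence A θ → Algebra
  Quot A θ c = record
    { Carrier = Carrier A
    ; _≈_ = θ
    ; isEquiv = Congruence.equiv c
    ; op = op A
    ; op-cong = Congruence.compat c }

  data Join {C : Set} (θ θ' : Rel C 0ℓ) : Rel C 0ℓ where
    inl  : ∀ {x y} → θ x y → Join θ θ' x y
    inr  : ∀ {x y} → θ' x y → Join θ θ' x y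
    tran : ∀ {x y z} → Join θ θ' x y → Join θ θ' y z → Join θ θ' x z

  Compose : {C : Set} → Rel C 0ℓ → Rel C 0ℓ → Rel C 0ℓ
  Compose θ θ' x y = Σ _ (λ z → θ x z × θ' z y)

  IsFactorCongruence : (A : Algebra) (θ : Rel (Carrier A) 0ℓ) → Set₁
  IsFactorCongruence A θ =
    Σ[ θ' ∈ Rel (Carrier A) 0ℓ ] Congruence A θ' ×
      (∀ x y → θ x y → θ' x y → _≈_ A x y) ×
      (∀ x y → Join θ θ' x y) ×
      (∀ x y → Compose θ θ' x y → Compose θ' θ x y) ×
      (∀ x y → Compose θ' θ x y → Compose θ θ' x y)

  module _ (E : Eqns) where

    data Deriv {X : Set} : Term X → Term X → Set where
      drefl  : ∀ {t} → Deriv t t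
      dsym   : ∀ {s t} → Deriv s t → Deriv t s
      dtrans : ∀ {s t u} → Deriv s t → Deriv t u → Deriv s u
      dcong  : ∀ f {ss ts : Fin (arity f) → Term X} →
               (∀ i → Deriv (ss i) (ts i)) → Deriv (app f ss) (app f ts)
      dax    : ∀ {s t} → E s t → (σ : ℕ → Term X) → Deriv (sub s σ) (sub t σ)

    Free : Set → Algebra
    Free X = record
      { Carrier = Term X
      ; _≈_ = Deriv
      ; isEquiv = record { refl = drefl ; sym = dsym ; trans = dtrans }
      ; op = app
      ; op-cong = dcong }

    Projective : Algebra → Set₁
    Projective B = Σ[ X ∈ Set ] Σ[ r ∈ Hom (Free X) B ] Σ[ s ∈ Hom B (Free X) ]
                     (∀ b → _≈_ B (fun r (fun s b)) b)

    MsFull : Set₁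
    MsFull = ∀ (A : Algebra) → Satisfies E A → Nontrivial A → HasMinimalSubalgebra A

    MhFull : Algebra → Set₁
    MhFull A = ∀ (M : Algebra) → Satisfies E M → Minimal M →
               Σ[ h ∈ Hom A M ] Surjective h

module Submission where

-- (⇒) A retraction B → F(X) followed by the homomorphism F(X) → M sending every
-- generator to one element of a minimal M is a homomorphism B → M, and it is onto
-- because its image is a nonempty subuniverse of M.
-- (⇐) F(n) is nontrivial, so by ms-fullness it has a minimal subalgebra M, which
-- lies in the variety; mh-fullness gives a homomorphism g : F(n)/θ → M ⊆ F(n).
-- As F(n) ≅ F(n)/θ × F(n)/θ', pairing the identity of F(n)/θ with g modulo θ'
-- yields a section F(n)/θ → F(n) of the quotient map.

open import Defs
open import Data.Nat using (ℕ)
open import Data.Fin using (Fin)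
open import Data.Product using (_×_; _,_; proj₁; proj₂; Σ)
open import Level using (0ℓ)
open import Relation.Binary using (Rel; IsEquivalence)

open Algebra
open Hom

module _ {S : Sig} where

  module ≈ (A : Algebra S) = IsEquivalence (isEquiv A)

  idHom : (A : Algebra S) → Hom S A A
  idHom A = record { fun = λ x → x ; cong = λ e → e ; hom = λ f xs → ≈.refl A }

  _∘H_ : {A B C : Algebra S} → Hom S B C → Hom S A B → Hom S A C
  _∘H_ {C = C} g h = record
    { fun  = λ x → fun g (fun h x)
    ; cong = λ e → cong g (cong h e)
    ; hom  = λ f xs → ≈.trans C (cong g (hom h f xs)) (hom g f _)
    }

  quotientMap : (A : Algebra S) {θ : Rel (Carrier A) 0ℓ} (c : Congruence S A θ) →
    Hom S A (Quot S A θ c)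
  quotientMap A c = record
    { fun = λ x → x ; cong = Congruence.≈⊆θ c ; hom = λ f xs → IsEquivalence.refl (Congruence.equiv c) }

  inclusion : (A : Algebra S) (P : Carrier A → Set) (su : Subuniverse S A P) →
    Hom S (SubAlg S A P su) A
  inclusion A P su = record { fun = proj₁ ; cong = λ e → e ; hom = λ f xs → ≈.refl A }

  Quot-nontrivial⇒nontrivial : (A : Algebra S) {θ : Rel (Carrier A) 0ℓ} (c : Congruence S A θ) →
    Nontrivial S (Quot S A θ c) → Nontrivial S A
  Quot-nontrivial⇒nontrivial A c (a , b , a≉b) = a , b , λ a≈b → a≉b (Congruence.≈⊆θ c a≈b)

  evalVars : {X : Set} (A : Algebra S) → (X → Carrier A) → Term S X → Carrier A
  evalVars A ρ (var x)    = ρ x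
  evalVars A ρ (app f ts) = op A f (λ i → evalVars A ρ (ts i))

  evalVars-sub : {X : Set} (A : Algebra S) (ρ : X → Carrier A) (s : Term S ℕ) (σ : ℕ → Term S X) →
    _≈_ A (evalVars A ρ (sub S s σ)) (eval S A (λ k → evalVars A ρ (σ k)) s)
  evalVars-sub A ρ (var x)    σ = ≈.refl A
  evalVars-sub A ρ (app f ts) σ = op-cong A f (λ i → evalVars-sub A ρ (ts i) σ)

  evalVars-sound : {X : Set} (E : Eqns S) (A : Algebra S) → Satisfies S E A → (ρ : X → Carrier A) →
    ∀ {s t} → Deriv S E s t → _≈_ A (evalVars A ρ s) (evalVars A ρ t)
  evalVars-sound E A sat ρ drefl          = ≈.refl A
  evalVars-sound E A sat ρ (dsym d)       = ≈.sym A (evalVars-sound E A sat ρ d)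
  evalVars-sound E A sat ρ (dtrans d d′)  =
    ≈.trans A (evalVars-sound E A sat ρ d) (evalVars-sound E A sat ρ d′)
  evalVars-sound E A sat ρ (dcong f ds)   = op-cong A f (λ i → evalVars-sound E A sat ρ (ds i))
  evalVars-sound E A sat ρ (dax {s} {t} e σ) =
    ≈.trans A (evalVars-sub A ρ s σ)
      (≈.trans A (sat s t e _) (≈.sym A (evalVars-sub A ρ t σ)))

  freeLift : {X : Set} (E : Eqns S) (A : Algebra S) → Satisfies S E A →
    (X → Carrier A) → Hom S (Free S E X) A
  freeLift E A sat ρ = record
    { fun = evalVars A ρ ; cong = evalVars-sound E A sat ρ ; hom = λ f xs → ≈.refl A }

  eval-Free : {X : Set} (E : Eqns S) (σ : ℕ → Term S X) (t : Term S ℕ) →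
    Deriv S E (eval S (Free S E X) σ t) (sub S t σ)
  eval-Free E σ (var x)    = drefl
  eval-Free E σ (app f ts) = dcong f (λ i → eval-Free E σ (ts i))

  Free-satisfies : {X : Set} (E : Eqns S) → Satisfies S E (Free S E X)
  Free-satisfies E s t e σ =
    dtrans (eval-Free E σ s) (dtrans (dax e σ) (dsym (eval-Free E σ t)))

  eval-SubAlg : (A : Algebra S) (P : Carrier A → Set) (su : Subuniverse S A P)
    (ρ : ℕ → Carrier (SubAlg S A P su)) (t : Term S ℕ) →
    _≈_ A (proj₁ (eval S (SubAlg S A P su) ρ t)) (eval S A (λ k → proj₁ (ρ k)) t)
  eval-SubAlg A P su ρ (var x)    = ≈.refl A
  eval-SubAlg A P su ρ (app f ts) = op-cong A f (λ i → eval-SubAlg A P su ρ (ts i))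

  SubAlg-satisfies : (E : Eqns S) (A : Algebra S) (P : Carrier A → Set) (su : Subuniverse S A P) →
    Satisfies S E A → Satisfies S E (SubAlg S A P su)
  SubAlg-satisfies E A P su sat s t e ρ =
    ≈.trans A (eval-SubAlg A P su ρ s) (≈.trans A (sat s t e _) (≈.sym A (eval-SubAlg A P su ρ t)))

  hom-into-minimal-surjective : (B M : Algebra S) → Minimal S M → Carrier B →
    (h : Hom S B M) → Surjective S h
  hom-into-minimal-surjective B M (_ , minimal) b h = minimal Image image-subuniverse (fun h b , b , ≈.refl M)
    where
      Image : Carrier M → Set
      Image y = Σ (Carrier B) (λ x → _≈_ M (fun h x) y)

      image-subuniverse : Subuniverse S M Image
      image-subuniverse = record
        { respects = λ y≈y′ (x , hx≈y) → x , ≈.trans M hx≈y y≈y′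
        ; closed   = λ f ys preimages → op B f (λ i → proj₁ (preimages i)) ,
            ≈.trans M (hom h f _) (op-cong M f (λ i → proj₂ (preimages i)))
        }

  module _ {C : Set} {θ θ′ : Rel C 0ℓ} (θ-equiv : IsEquivalence θ) (θ′-equiv : IsEquivalence θ′) where
    private
      module θ  = IsEquivalence θ-equiv
      module θ′ = IsEquivalence θ′-equiv

    join⇒compose : (∀ x y → Compose S θ′ θ x y → Compose S θ θ′ x y) →
      ∀ x y → Join S θ θ′ x y → Compose S θ θ′ x y
    join⇒compose permute x y (Join.inl xθy)  = y , xθy , θ′.refl
    join⇒compose permute x y (Join.inr xθ′y) = x , θ.refl , xθ′y
    join⇒compose permute x z (Join.tran {y = y} j k)
      with join⇒compose permute _ _ j | join⇒compose permute _ _ k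
    ... | a , xθa , aθ′y | b , yθb , bθ′z with permute a b (y , aθ′y , yθb)
    ... | d , aθd , dθ′b = d , θ.trans xθa aθd , θ′.trans dθ′b bθ′z

  module FactorPairing (A : Algebra S) {θ : Rel (Carrier A) 0ℓ} (c : Congruence S A θ)
                       (factor : IsFactorCongruence S A θ) where
    θ′ : Rel (Carrier A) 0ℓ
    θ′ = proj₁ factor

    c′ : Congruence S A θ′
    c′ = proj₁ (proj₂ factor)

    private
      module θ  = IsEquivalence (Congruence.equiv c)
      module θ′ = IsEquivalence (Congruence.equiv c′)
      separates : ∀ x y → θ x y → θ′ x y → _≈_ A x y
      separates = proj₁ (proj₂ (proj₂ factor))

      join-total : ∀ x y → Join S θ θ′ x y
      join-total = proj₁ (proj₂ (proj₂ (proj₂ factor)))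

      permutes : ∀ x y → Compose S θ′ θ x y → Compose S θ θ′ x y
      permutes = proj₂ (proj₂ (proj₂ (proj₂ (proj₂ factor))))

    θθ′-total : ∀ x y → Compose S θ θ′ x y
    θθ′-total x y = join⇒compose (Congruence.equiv c) (Congruence.equiv c′) permutes x y (join-total x y)

    module _ (B : Algebra S) (g : Hom S B (Quot S A θ c)) (h : Hom S B (Quot S A θ′ c′)) where
      pairing : Carrier B → Carrier A
      pairing b = proj₁ (θθ′-total (fun g b) (fun h b))

      pairing-θ : ∀ b → θ (pairing b) (fun g b)
      pairing-θ b = θ.sym (proj₁ (proj₂ (θθ′-total (fun g b) (fun h b))))

      pairing-θ′ : ∀ b → θ′ (pairing b) (fun h b)
      pairing-θ′ b = proj₂ (proj₂ (θθ′-total (fun g b) (fun h b)))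

      pair : Hom S B A
      pair = record { fun = pairing ; cong = pairing-cong ; hom = pairing-hom }
        where
          pairing-cong : ∀ {x y} → _≈_ B x y → _≈_ A (pairing x) (pairing y)
          pairing-cong {x} {y} x≈y = separates _ _
            (θ.trans (pairing-θ x) (θ.trans (cong g x≈y) (θ.sym (pairing-θ y))))
            (θ′.trans (pairing-θ′ x) (θ′.trans (cong h x≈y) (θ′.sym (pairing-θ′ y))))

          pairing-hom : ∀ f xs → _≈_ A (pairing (op B f xs)) (op A f (λ i → pairing (xs i)))
          pairing-hom f xs = separates _ _
            (θ.trans (pairing-θ _)
              (θ.trans (hom g f xs) (Congruence.compat c f (λ i → θ.sym (pairing-θ (xs i))))))
            (θ′.trans (pairing-θ′ _)
              (θ′.trans (hom h f xs) (Congruence.compat c′ f (λ i → θ′.sym (pairing-θ′ (xs i))))))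

    -- Only the θ-component matters; any homomorphism into A provides the θ′-component.
    quotientMap-section : Hom S (Quot S A θ c) A →
      Σ (Hom S (Quot S A θ c) A) (λ s → ∀ b → θ (fun s b) b)
    quotientMap-section g = pair B (idHom B) g′ , pairing-θ B (idHom B) g′
      where
        B : Algebra S
        B = Quot S A θ c

        g′ : Hom S B (Quot S A θ′ c′)
        g′ = quotientMap A c′ ∘H g

  module _ (E : Eqns S) where

    projective⇒mhFull : (B : Algebra S) → Carrier B → Projective S E B → MhFull S E B
    projective⇒mhFull B b (X , _ , s , _) M M⊨E M-minimal =
      g , hom-into-minimal-surjective B M M-minimal b g
      where
        g : Hom S B M
        g = freeLift E M M⊨E (λ _ → proj₁ (proj₁ M-minimal)) ∘H s

    mhFull⇒hom-to-Free : {X : Set} → MsFull S E → Nontrivial S (Free S E X) →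
      (B : Algebra S) → MhFull S E B → Hom S B (Free S E X)
    mhFull⇒hom-to-Free {X} msFull F-nontrivial B mhFull =
      inclusion F P su ∘H proj₁ (mhFull M (SubAlg-satisfies E F P su (Free-satisfies E)) M-minimal)
      where
        F : Algebra S
        F = Free S E X

        minimalSubalgebra : HasMinimalSubalgebra S F
        minimalSubalgebra = msFull F (Free-satisfies E) F-nontrivial

        P : Carrier F → Set
        P = proj₁ minimalSubalgebra

        su : Subuniverse S F P
        su = proj₁ (proj₂ minimalSubalgebra)

        M : Algebra S
        M = SubAlg S F P su

        M-minimal : Minimal S M
        M-minimal = proj₂ (proj₂ minimalSubalgebra)

mainTheorem2 : (S : Sig) (E : Eqns S) → MsFull S E →
    (n : ℕ) (θ : Term S (Fin n) → Term S (Fin n) → Set)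
    (c : Congruence S (Free S E (Fin n)) θ) →
    IsFactorCongruence S (Free S E (Fin n)) θ →
    Nontrivial S (Quot S (Free S E (Fin n)) θ c) →
    (Projective S E (Quot S (Free S E (Fin n)) θ c) → MhFull S E (Quot S (Free S E (Fin n)) θ c)) ×
    (MhFull S E (Quot S (Free S E (Fin n)) θ c) → Projective S E (Quot S (Free S E (Fin n)) θ c))
mainTheorem2 S E msFull n θ c factor B-nontrivial =
  projective⇒mhFull E B (proj₁ B-nontrivial) , mhFull⇒projective
  where
    F : Algebra S
    F = Free S E (Fin n)

    B : Algebra S
    B = Quot S F θ c

    mhFull⇒projective : MhFull S E B → Projective S E B
    mhFull⇒projective mhFull = Fin n , quotientMap F c , FactorPairing.quotientMap-section F c factor g
      where
        g : Hom S B F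
        g = mhFull⇒hom-to-Free E msFull (Quot-nontrivial⇒nontrivial F c B-nontrivial) B mhFull
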